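{- Let $R < 10/7$ be a real number, $\lambda$ a positive integer, and $\mathcal{F} = \{F^c_{t,k}\}$ an F-system such that $|F^A_t \cup F^B_t| \le R t + \lambda$ for every positive integer $t$. Then for every positive integer $t$, $|S_{2t,t}| \ge (6-4R)t - 2\lambda$.
   Context: An F-system is a family $\mathcal{F} = \{F^c_{t,k}\}$ of sets of positive integers, indexed by $c \in \{A,B\}$ and integers $t,k$ with $0 < k \le t$, such that (F1) $|F^c_{t,k}| \ge k$ for all $c,t,k$, and (F2) $F^A_{t,k} \cap F^B_{t',k'} = \emptyset$ for all $k,t,k',t'$ with $k + k' \le \max(t,t')$. For $c \in \{A,B\}$ and a positive integer $t$, $F^c_t = \bigcup_{\kappa \le \tau \le t} F^c_{\tau,\kappa}$ (union over integers $0<\kappa\le\tau\le t$), $S_t = F^A_t \cap F^B_t$, and $S_{2t,t} = S_{2t} \cap (F^A_{2t,t} \cup F^B_{2t,t})$.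
   Formalization: The number R ranges over the rationals rather than the real numbers. -}

module Defs where

open import Data.Nat using (ℕ; zero; suc; _+_; _*_; _≤_; _<_; _⊔_)
open import Data.Nat.Properties using (_≟_)
open import Data.List using (List; []; _∷_; _++_; map; concatMap; upTo; filter; length; deduplicate)
open import Data.List.Membership.Propositional using (_∈_)
open import Data.List.Membership.DecPropositional _≟_ using (_∈?_)
open import Data.List.Relation.Unary.All using (All)
open import Data.Empty using (⊥)
open import Data.Product using (_×_)
open import Data.Rational using (ℚ)
open import Data.Integer using (+_)
import Data.Rational as Q

data Col : Set where
  A B : Col

-- Finite sets of natural numbers are represented by lists (duplicates allowed;
-- the set is the set of members of the list).
FinSet : Set
FinSet = List ℕ

card : FinSet → ℕ
card xs = length (deduplicate _≟_ xs)

_∪ˢ_ : FinSet → FinSet → FinSet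
xs ∪ˢ ys = xs ++ ys

_∩ˢ_ : FinSet → FinSet → FinSet
xs ∩ˢ ys = filter (λ x → x ∈? ys) xs

range1 : ℕ → List ℕ
range1 n = map suc (upTo n)

-- A family F c t k (only meaningful for 0 < k ≤ t)
Family : Set
Family = Col → ℕ → ℕ → FinSet

record IsFSystem (F : Family) : Set where
  field
    positive : ∀ c t k → 0 < k → k ≤ t → All (λ x → 0 < x) (F c t k)
    F1 : ∀ c t k → 0 < k → k ≤ t → k ≤ card (F c t k)
    F2 : ∀ t k t' k' → 0 < k → k ≤ t → 0 < k' → k' ≤ t' →
         k + k' ≤ t ⊔ t' →
         ∀ x → x ∈ F A t k → x ∈ F B t' k' → ⊥

Fc : Family → Col → ℕ → FinSet
Fc F c t = concatMap (λ τ → concatMap (λ κ → F c τ κ) (range1 τ)) (range1 t)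

S : Family → ℕ → FinSet
S F t = Fc F A t ∩ˢ Fc F B t

S2 : Family → ℕ → FinSet
S2 F t = S F (2 * t) ∩ˢ (F A (2 * t) t ∪ˢ F B (2 * t) t)

ℕ→ℚ : ℕ → ℚ
ℕ→ℚ n = (+ n) Q./ 1

module Submission where

-- Write X^c = F^c_{2t,t}, P^c = F^c_{2t,2t} (half c, full c below), D = S_{2t,t}, U = F^A_{2t} ∪ F^B_{2t}.
-- By (F2) with t + t ≤ 2t the sets X^A and X^B are disjoint, so |X^A ∩ D| + |X^B ∩ D| ≤ |D|.
-- An element of X^c ∖ D cannot lie in P^c̄ (it would then be in F^A_{2t} ∩ F^B_{2t}, hence in D),
-- so the disjoint subsets X^c ∖ D and P^c̄ of U give |X^c ∖ D| + 2t ≤ |U|.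
-- Adding up with |X^c| ≥ t yields 6t ≤ |D| + 2|U| ≤ |D| + 2(2Rt + λ).

open import Defs
open import Data.Nat using (ℕ)
open import Data.Rational using (ℚ; _≤_; _<_; _+_; _*_; _-_; _/_)
open import Data.Integer using (+_)
import Data.Nat as N

import Data.Nat.Properties as NP
import Data.Integer as Z
import Data.Integer.Properties as ZP
import Data.Rational as Q
import Data.Rational.Properties as QP
import Data.Rational.Solver as QS
import Data.Nat.Coprimality as Coprime
open import Data.Nat.Solver using (module +-*-Solver)
open import Data.List using (List; []; _∷_; _++_; filter; length; deduplicate)
open import Data.List.Properties using (length-++; length-removeAt′)
open import Data.List.Membership.Propositional using (_∈_; _∉_)
open import Data.List.Membership.DecPropositional NP._≟_ using (_∈?_; _∉?_)
open import Data.List.Membership.Propositional.Properties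
open import Data.List.Relation.Unary.Any using (here; there; _─_)
open import Data.List.Relation.Unary.All using (lookup)
open import Data.List.Relation.Unary.AllPairs using (_∷_)
open import Data.List.Relation.Unary.Unique.Propositional using (Unique)
open import Data.List.Relation.Unary.Unique.Propositional.Properties using (++⁺)
open import Data.List.Relation.Unary.Unique.DecPropositional.Properties NP._≟_ using (deduplicate-!)
open import Data.List.Relation.Binary.Subset.Propositional using (_⊆_)
open import Data.List.Relation.Binary.Disjoint.Propositional using (Disjoint)
open import Data.Empty using (⊥-elim)
open import Data.Product using (_×_; _,_; proj₁; proj₂)
open import Data.Sum using (_⊎_; inj₁; inj₂)
open import Relation.Nullary using (yes; no)
open import Relation.Binary.PropositionalEquality
open import Function using (_∘_)

_∖ˢ_ : FinSet → FinSet → FinSet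
xs ∖ˢ ys = filter (_∉? ys) xs

∈-─ : ∀ {A : Set} {x y : A} {ys} (y∈ys : y ∈ ys) → x ∈ ys → x ≢ y → x ∈ (ys ─ y∈ys)
∈-─ (here refl) (here refl) x≢y = ⊥-elim (x≢y refl)
∈-─ (here _)    (there x∈ys) _  = x∈ys
∈-─ (there _)   (here refl)  _  = here refl
∈-─ (there y∈ys) (there x∈ys) x≢y = there (∈-─ y∈ys x∈ys x≢y)

Unique⇒length-mono-⊆ : ∀ {A : Set} {xs ys : List A} → Unique xs → xs ⊆ ys → length xs N.≤ length ys
Unique⇒length-mono-⊆ {xs = []} _ _ = N.z≤n
Unique⇒length-mono-⊆ {xs = x ∷ xs} {ys} (x∉xs ∷ u) xs⊆ys =
  subst (length (x ∷ xs) N.≤_) (sym (length-removeAt′ ys _))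
    (N.s≤s (Unique⇒length-mono-⊆ u λ y∈xs →
      ∈-─ x∈ys (xs⊆ys (there y∈xs)) (λ y≡x → lookup x∉xs y∈xs (sym y≡x))))
  where x∈ys = xs⊆ys (here refl)

dedup : FinSet → List ℕ
dedup = deduplicate NP._≟_

dedup⁺ : ∀ {xs} → xs ⊆ dedup xs
dedup⁺ = ∈-deduplicate⁺ NP._≟_

dedup⁻ : ∀ {xs} → dedup xs ⊆ xs
dedup⁻ {xs} = ∈-deduplicate⁻ NP._≟_ xs

card-mono : ∀ {xs ys} → xs ⊆ ys → card xs N.≤ card ys
card-mono xs⊆ys = Unique⇒length-mono-⊆ (deduplicate-! _) (dedup⁺ ∘ xs⊆ys ∘ dedup⁻)

card-∪ˢ : ∀ xs ys → card (xs ∪ˢ ys) N.≤ card xs N.+ card ys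
card-∪ˢ xs ys = subst (card (xs ∪ˢ ys) N.≤_) (length-++ (dedup xs))
  (Unique⇒length-mono-⊆ (deduplicate-! _) λ z∈ → split (∈-++⁻ xs (dedup⁻ z∈)))
  where
  split : ∀ {z} → z ∈ xs ⊎ z ∈ ys → z ∈ dedup xs ++ dedup ys
  split (inj₁ z∈xs) = ∈-++⁺ˡ (dedup⁺ z∈xs)
  split (inj₂ z∈ys) = ∈-++⁺ʳ (dedup xs) (dedup⁺ z∈ys)

card-disjoint-⊆ : ∀ {xs ys zs} → Disjoint xs ys → xs ⊆ zs → ys ⊆ zs →
  card xs N.+ card ys N.≤ card zs
card-disjoint-⊆ {xs} {ys} {zs} disjoint xs⊆zs ys⊆zs =
  subst (N._≤ card zs) (length-++ (dedup xs))
    (Unique⇒length-mono-⊆ unique λ z∈ → dedup⁺ (subset (∈-++⁻ (dedup xs) z∈)))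
  where
  unique : Unique (dedup xs ++ dedup ys)
  unique = ++⁺ (deduplicate-! xs) (deduplicate-! ys)
    λ (z∈xs , z∈ys) → disjoint (dedup⁻ z∈xs , dedup⁻ z∈ys)
  subset : ∀ {z} → z ∈ dedup xs ⊎ z ∈ dedup ys → z ∈ zs
  subset (inj₁ z∈xs) = xs⊆zs (dedup⁻ z∈xs)
  subset (inj₂ z∈ys) = ys⊆zs (dedup⁻ z∈ys)

∈-∩ˢ⁺ : ∀ {x} xs ys → x ∈ xs → x ∈ ys → x ∈ xs ∩ˢ ys
∈-∩ˢ⁺ xs ys = ∈-filter⁺ (_∈? ys)

∈-∩ˢ⁻ : ∀ {x} xs ys → x ∈ xs ∩ˢ ys → x ∈ xs × x ∈ ys
∈-∩ˢ⁻ xs ys = ∈-filter⁻ (_∈? ys)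

∈-∖ˢ⁻ : ∀ {x} xs ys → x ∈ xs ∖ˢ ys → x ∈ xs × x ∉ ys
∈-∖ˢ⁻ xs ys = ∈-filter⁻ (_∉? ys)

card-∩ˢ-∖ˢ : ∀ xs ys → card xs N.≤ card (xs ∩ˢ ys) N.+ card (xs ∖ˢ ys)
card-∩ˢ-∖ˢ xs ys = NP.≤-trans (card-mono split) (card-∪ˢ (xs ∩ˢ ys) (xs ∖ˢ ys))
  where
  split : xs ⊆ (xs ∩ˢ ys) ∪ˢ (xs ∖ˢ ys)
  split {x} x∈xs with x ∈? ys
  ... | yes x∈ys = ∈-++⁺ˡ (∈-∩ˢ⁺ xs ys x∈xs x∈ys)
  ... | no  x∉ys = ∈-++⁺ʳ (xs ∩ˢ ys) (∈-filter⁺ (_∉? ys) x∈xs x∉ys)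

∈-range1 : ∀ {k n} → 0 N.< k → k N.≤ n → k ∈ range1 n
∈-range1 {N.suc k} _ k<n = ∈-map⁺ N.suc (∈-upTo⁺ k<n)

F⊆Fc : ∀ F c {τ κ T} → 0 N.< κ → κ N.≤ τ → τ N.≤ T → F c τ κ ⊆ Fc F c T
F⊆Fc F c 0<κ κ≤τ τ≤T x∈F =
  ∈-concat⁺′ (∈-concat⁺′ x∈F (∈-map⁺ _ (∈-range1 0<κ κ≤τ)))
             (∈-map⁺ _ (∈-range1 (NP.<-≤-trans 0<κ κ≤τ) τ≤T))

⊆-∪ˢ-Col : ∀ (G : Col → FinSet) c → G c ⊆ G A ∪ˢ G B
⊆-∪ˢ-Col G A = ∈-++⁺ˡ
⊆-∪ˢ-Col G B = ∈-++⁺ʳ (G A)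

opposite : Col → Col
opposite A = B
opposite B = A

∈-S : ∀ F c {T x} → x ∈ Fc F c T → x ∈ Fc F (opposite c) T → x ∈ S F T
∈-S F A {T} x∈A x∈B = ∈-∩ˢ⁺ (Fc F A T) (Fc F B T) x∈A x∈B
∈-S F B {T} x∈B x∈A = ∈-∩ˢ⁺ (Fc F A T) (Fc F B T) x∈A x∈B

module Halves {F : Family} (isF : IsFSystem F) {t : ℕ} (0<t : 0 N.< t) where
  open IsFSystem isF

  half full : Col → FinSet
  half c = F c (2 N.* t) t
  full c = F c (2 N.* t) (2 N.* t)

  U : FinSet
  U = Fc F A (2 N.* t) ∪ˢ Fc F B (2 N.* t)

  t≤2t : t N.≤ 2 N.* t
  t≤2t = NP.m≤n*m t 2

  0<2t : 0 N.< 2 N.* t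
  0<2t = NP.<-≤-trans 0<t t≤2t

  half⊆Fc : ∀ c → half c ⊆ Fc F c (2 N.* t)
  half⊆Fc c = F⊆Fc F c {T = 2 N.* t} 0<t t≤2t NP.≤-refl

  full⊆Fc : ∀ c → full c ⊆ Fc F c (2 N.* t)
  full⊆Fc c = F⊆Fc F c {T = 2 N.* t} 0<2t NP.≤-refl NP.≤-refl

  ⊆U : ∀ c {xs} → xs ⊆ Fc F c (2 N.* t) → xs ⊆ U
  ⊆U c xs⊆Fc = ⊆-∪ˢ-Col (λ c → Fc F c (2 N.* t)) c ∘ xs⊆Fc

  ∈-S2 : ∀ c {x} → x ∈ half c → x ∈ Fc F (opposite c) (2 N.* t) → x ∈ S2 F t
  ∈-S2 c x∈half x∈Fc = ∈-∩ˢ⁺ (S F (2 N.* t)) (half A ∪ˢ half B)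
    (∈-S F c {2 N.* t} (half⊆Fc c x∈half) x∈Fc) (⊆-∪ˢ-Col half c x∈half)

  halves-disjoint : Disjoint (half A) (half B)
  halves-disjoint {x} (x∈A , x∈B) =
    F2 (2 N.* t) t (2 N.* t) t 0<t t≤2t 0<t t≤2t t+t≤2t⊔2t x x∈A x∈B
    where
    t+t≤2t⊔2t : t N.+ t N.≤ (2 N.* t) N.⊔ (2 N.* t)
    t+t≤2t⊔2t rewrite NP.⊔-idem (2 N.* t) | NP.+-identityʳ t = NP.≤-refl

  card-∩S2 : card (half A ∩ˢ S2 F t) N.+ card (half B ∩ˢ S2 F t) N.≤ card (S2 F t)
  card-∩S2 = card-disjoint-⊆
    (λ (x∈A , x∈B) → halves-disjoint (proj₁ (∈-∩ˢ⁻ (half A) _ x∈A) , proj₁ (∈-∩ˢ⁻ (half B) _ x∈B)))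
    (proj₂ ∘ ∈-∩ˢ⁻ (half A) (S2 F t)) (proj₂ ∘ ∈-∩ˢ⁻ (half B) (S2 F t))

  card-∖S2 : ∀ c → card (half c ∖ˢ S2 F t) N.+ 2 N.* t N.≤ card U
  card-∖S2 c = NP.≤-trans (NP.+-monoʳ-≤ _ (F1 (opposite c) _ _ 0<2t NP.≤-refl))
    (card-disjoint-⊆ disjoint (⊆U c (half⊆Fc c ∘ proj₁ ∘ ∈-∖ˢ⁻ (half c) (S2 F t)))
                              (⊆U (opposite c) (full⊆Fc (opposite c))))
    where
    disjoint : Disjoint (half c ∖ˢ S2 F t) (full (opposite c))
    disjoint (x∈ , x∈full) with ∈-∖ˢ⁻ (half c) (S2 F t) x∈
    ... | x∈half , x∉S2 = x∉S2 (∈-S2 c x∈half (full⊆Fc (opposite c) x∈full))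

  t≤card-half : ∀ c → t N.≤ card (half c ∩ˢ S2 F t) N.+ card (half c ∖ˢ S2 F t)
  t≤card-half c = NP.≤-trans (F1 c _ _ 0<t t≤2t) (card-∩ˢ-∖ˢ (half c) (S2 F t))

  6t≤card-S2+2card-U : 6 N.* t N.≤ card (S2 F t) N.+ 2 N.* card U
  6t≤card-S2+2card-U = begin
    6 N.* t                                  ≡⟨ regroup₁ t ⟩
    (t N.+ t) N.+ (2 N.* t N.+ 2 N.* t)      ≤⟨ NP.+-monoˡ-≤ _ (NP.+-mono-≤ (t≤card-half A) (t≤card-half B)) ⟩
    ((a∩ N.+ a∖) N.+ (b∩ N.+ b∖)) N.+ (2 N.* t N.+ 2 N.* t)
                                             ≡⟨ regroup₂ a∩ a∖ b∩ b∖ (2 N.* t) ⟩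
    (a∩ N.+ b∩) N.+ ((a∖ N.+ 2 N.* t) N.+ (b∖ N.+ 2 N.* t))
                                             ≤⟨ NP.+-mono-≤ card-∩S2 (NP.+-mono-≤ (card-∖S2 A) (card-∖S2 B)) ⟩
    card (S2 F t) N.+ (card U N.+ card U)    ≡⟨ cong (card (S2 F t) N.+_) (regroup₃ (card U)) ⟩
    card (S2 F t) N.+ 2 N.* card U           ∎
    where
    open NP.≤-Reasoning
    open +-*-Solver
    a∩ = card (half A ∩ˢ S2 F t)
    a∖ = card (half A ∖ˢ S2 F t)
    b∩ = card (half B ∩ˢ S2 F t)
    b∖ = card (half B ∖ˢ S2 F t)
    regroup₁ : ∀ t → 6 N.* t ≡ (t N.+ t) N.+ (2 N.* t N.+ 2 N.* t)
    regroup₁ = solve 1 (λ t → con 6 :* t := (t :+ t) :+ (con 2 :* t :+ con 2 :* t)) refl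
    regroup₂ : ∀ a b c d e → ((a N.+ b) N.+ (c N.+ d)) N.+ (e N.+ e) ≡ (a N.+ c) N.+ ((b N.+ e) N.+ (d N.+ e))
    regroup₂ = solve 5 (λ a b c d e → ((a :+ b) :+ (c :+ d)) :+ (e :+ e) := (a :+ c) :+ ((b :+ e) :+ (d :+ e))) refl
    regroup₃ : ∀ u → u N.+ u ≡ 2 N.* u
    regroup₃ = solve 1 (λ u → u :+ u := con 2 :* u) refl

ℕ→ℚ≡mkℚ : ∀ n → ℕ→ℚ n ≡ Q.mkℚ (+ n) 0 (Coprime.sym (Coprime.1-coprimeTo n))
ℕ→ℚ≡mkℚ n = QP.normalize-coprime (Coprime.sym (Coprime.1-coprimeTo n))

ℕ→ℚ-+ : ∀ m n → ℕ→ℚ (m N.+ n) ≡ ℕ→ℚ m + ℕ→ℚ n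
ℕ→ℚ-+ m n rewrite ℕ→ℚ≡mkℚ m | ℕ→ℚ≡mkℚ n =
  cong (_/ 1) (cong₂ Z._+_ (sym (ZP.*-identityʳ (+ m))) (sym (ZP.*-identityʳ (+ n))))

ℕ→ℚ-* : ∀ m n → ℕ→ℚ (m N.* n) ≡ ℕ→ℚ m * ℕ→ℚ n
ℕ→ℚ-* m n rewrite ℕ→ℚ≡mkℚ m | ℕ→ℚ≡mkℚ n = cong (_/ 1) (ZP.pos-* m n)

ℕ→ℚ-mono-≤ : ∀ {m n} → m N.≤ n → ℕ→ℚ m ≤ ℕ→ℚ n
ℕ→ℚ-mono-≤ {m} {n} m≤n rewrite ℕ→ℚ≡mkℚ m | ℕ→ℚ≡mkℚ n =
  Q.*≤* (subst₂ Z._≤_ (sym (ZP.*-identityʳ (+ m))) (sym (ZP.*-identityʳ (+ n))) (Z.+≤+ m≤n))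

a≤d+wu⇒a-wr≤d : ∀ w .{{_ : Q.NonNegative w}} {a d u r} → a ≤ d + w * u → u ≤ r → a - w * r ≤ d
a≤d+wu⇒a-wr≤d w {a} {d} {u} {r} a≤d+wu u≤r = begin
  a - w * r            ≤⟨ QP.+-mono-≤ a≤d+wu (QP.neg-antimono-≤ (QP.*-monoˡ-≤-nonNeg w u≤r)) ⟩
  (d + w * u) - w * u  ≡⟨ cancel d (w * u) ⟩
  d                    ∎
  where
  open QP.≤-Reasoning
  open QS.+-*-Solver
  cancel : ∀ x y → (x + y) - y ≡ x
  cancel = solve 2 (λ x y → (x :+ y) :- y := x) refl

lemma3 : (R : ℚ) → R < (+ 10) / 7 → (lam : ℕ) → 0 N.< lam →
    (F : Family) → IsFSystem F →
    (∀ (t : ℕ) → 0 N.< t → ℕ→ℚ (card (Fc F A t ∪ˢ Fc F B t)) ≤ R * ℕ→ℚ t + ℕ→ℚ lam) →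
    ∀ (t : ℕ) → 0 N.< t →
    (ℕ→ℚ 6 - ℕ→ℚ 4 * R) * ℕ→ℚ t - ℕ→ℚ 2 * ℕ→ℚ lam ≤ ℕ→ℚ (card (S2 F t))
lemma3 R _ lam _ F isF card-U≤ t 0<t = begin
  (ℕ→ℚ 6 - ℕ→ℚ 4 * R) * T - ℕ→ℚ 2 * L   ≡⟨ expand R T L ⟩
  ℕ→ℚ 6 * T - ℕ→ℚ 2 * (R * (ℕ→ℚ 2 * T) + L)
                                          ≤⟨ a≤d+wu⇒a-wr≤d (ℕ→ℚ 2) 6t≤ ∣U∣≤ ⟩
  ℕ→ℚ (card (S2 F t))                     ∎
  where
  open QP.≤-Reasoning
  open Halves isF 0<t using (U; 0<2t; 6t≤card-S2+2card-U)
  T = ℕ→ℚ t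
  L = ℕ→ℚ lam
  6t≤ : ℕ→ℚ 6 * T ≤ ℕ→ℚ (card (S2 F t)) + ℕ→ℚ 2 * ℕ→ℚ (card U)
  6t≤ = subst₂ _≤_ (ℕ→ℚ-* 6 t)
    (trans (ℕ→ℚ-+ (card (S2 F t)) (2 N.* card U)) (cong (_+_ (ℕ→ℚ (card (S2 F t)))) (ℕ→ℚ-* 2 (card U))))
    (ℕ→ℚ-mono-≤ 6t≤card-S2+2card-U)
  ∣U∣≤ : ℕ→ℚ (card U) ≤ R * (ℕ→ℚ 2 * T) + L
  ∣U∣≤ = subst (λ x → ℕ→ℚ (card U) ≤ R * x + L) (ℕ→ℚ-* 2 t) (card-U≤ (2 N.* t) 0<2t)
  expand : ∀ R T L → (ℕ→ℚ 6 - ℕ→ℚ 4 * R) * T - ℕ→ℚ 2 * L ≡ ℕ→ℚ 6 * T - ℕ→ℚ 2 * (R * (ℕ→ℚ 2 * T) + L)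
  expand = solve 3 (λ R T L → (con (ℕ→ℚ 6) :- con (ℕ→ℚ 4) :* R) :* T :- con (ℕ→ℚ 2) :* L
                         := con (ℕ→ℚ 6) :* T :- con (ℕ→ℚ 2) :* (R :* (con (ℕ→ℚ 2) :* T) :+ L)) refl
    where open QS.+-*-Solver
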